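{- The constancy atoms $=\!(\bar v)$ and the inconstancy atoms $\neq\!(\bar v)$ are not definable in $\mathbf{FO}(\mathrm{NE}, \sqcup)$.
   Context: Team semantics (lax version). Let $\mathfrak M$ be a structure with domain $M$. A team $X$ is a set of assignments $s: V\to M$ on a common domain $V$. First-order parts of formulas are in negation normal form. Satisfaction: literal $\alpha$: every $s\in X$ satisfies $\alpha$ (Tarski); $\psi\vee\theta$: $X=Y\cup Z$ with $\mathfrak M\models_Y\psi$, $\mathfrak M\models_Z\theta$; $\wedge$: both; $\exists v\psi$: some $F: X\to\mathcal P(M)\setminus\{\emptyset\}$ with $\mathfrak M\models_{X[F/v]}\psi$, $X[F/v]=\{s[m/v]: s\in X,m\in F(s)\}$; $\forall v\psi$: $\mathfrak M\models_{X[M/v]}\psi$, $X[M/v]=\{s[m/v]: s\in X,m\in M\}$; $\varphi\sqcup\psi$: $\mathfrak M\models_X\varphi$ or $\mathfrak M\models_X\psi$; $\mathfrak M\models_X\mathrm{NE}$ iff $X\neq\emptyset$. Constancy: $\mathfrak M\models_X=\!(\bar v)$ iff $s(\bar v)=s'(\bar v)$ for all $s,s'\in X$; inconstancy: $\mathfrak M\models_X\neq\!(\bar v)$ iff there are $s,s'\in X$ with $s(\bar v)\neq s'(\bar v)$. An atom $\mathbf D\bar v$ with $\bar v$ a tuple of $k$ distinct variables is definable in a logic $L$ if there is a formula $\theta(\bar v)$ of $L$ over the empty vocabulary such that $\mathfrak M\models_X\mathbf D\bar v$ iff $\mathfrak M\models_X\theta(\bar v)$ for all structures $\mathfrak M$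 and teams $X$ whose domain contains $\bar v$. -}

module Defs where

open import Data.Nat using (ℕ; _≟_)
open import Data.Fin using (Fin)
open import Data.Product using (Σ; _×_; _,_; ∃)
open import Data.Sum using (_⊎_)
open import Data.Unit using (⊤)
open import Relation.Binary.PropositionalEquality using (_≡_; _≢_)
open import Relation.Nullary using (¬_; yes; no)
open import Level using (Level) renaming (suc to lsuc; zero to lzero)

Var : Set
Var = ℕ

-- Formulas of FO(NE, ⊔) over the empty vocabulary, first-order part in
-- negation normal form: literals are v = w and v ≠ w.
data Formula : Set where
  eqL  : Var → Var → Formula
  neqL : Var → Var → Formula
  NE   : Formula
  _∨ᶠ_ : Formula → Formula → Formula
  _∧ᶠ_ : Formula → Formula → Formula
  ∃ᶠ   : Var → Formula → Formula
  ∀ᶠ   : Var → Formula → Formula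
  _⊔ᶠ_ : Formula → Formula → Formula

Assignment : Set → Set
Assignment M = Var → M

Team : Set → Set₁
Team M = Assignment M → Set

update : {M : Set} → Assignment M → Var → M → Assignment M
update s v m u with u ≟ v
... | yes _ = m
... | no  _ = s u

-- X[F/v] = { s[m/v] : s ∈ X, m ∈ F(s) }
supplement : {M : Set} → Team M → Var → (Assignment M → M → Set) → Team M
supplement X v F s' = Σ _ λ s → X s × Σ _ λ m → F s m × (∀ u → s' u ≡ update s v m u)

-- X[M/v] = { s[m/v] : s ∈ X, m ∈ M }
duplicate : {M : Set} → Team M → Var → Team M
duplicate X v s' = Σ _ λ s → X s × Σ _ λ m → (∀ u → s' u ≡ update s v m u)

-- Lax team semantics.
Sat : (M : Set) → Formula → Team M → Set₁
Sat M (eqL v w)  X = Level.Lift _ (∀ s → X s → s v ≡ s w)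
Sat M (neqL v w) X = Level.Lift _ (∀ s → X s → s v ≢ s w)
Sat M NE         X = Level.Lift _ (Σ _ λ s → X s)
Sat M (φ ∨ᶠ ψ)   X = Σ (Team M) λ Y → Σ (Team M) λ Z →
                       (∀ s → (X s → Y s ⊎ Z s) × (Y s ⊎ Z s → X s)) × Sat M φ Y × Sat M ψ Z
Sat M (φ ∧ᶠ ψ)   X = Sat M φ X × Sat M ψ X
Sat M (∃ᶠ v φ)   X = Σ (Assignment M → M → Set) λ F →
                       (∀ s → X s → Σ M λ m → F s m) × Sat M φ (supplement X v F)
Sat M (∀ᶠ v φ)   X = Sat M φ (duplicate X v)
Sat M (φ ⊔ᶠ ψ)   X = Sat M φ X ⊎ Sat M ψ X

FreeAmong : (Var → Set) → Formula → Set
FreeAmong P (eqL v w)  = P v × P w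
FreeAmong P (neqL v w) = P v × P w
FreeAmong P NE         = ⊤
FreeAmong P (φ ∨ᶠ ψ)   = FreeAmong P φ × FreeAmong P ψ
FreeAmong P (φ ∧ᶠ ψ)   = FreeAmong P φ × FreeAmong P ψ
FreeAmong P (∃ᶠ v φ)   = FreeAmong (λ u → u ≡ v ⊎ P u) φ
FreeAmong P (∀ᶠ v φ)   = FreeAmong (λ u → u ≡ v ⊎ P u) φ
FreeAmong P (φ ⊔ᶠ ψ)   = FreeAmong P φ × FreeAmong P ψ

Atom : Set₁
Atom = (M : Set) → Team M → Set

Const : {k : ℕ} → (Fin k → Var) → Atom
Const vs M X = ∀ s s' → X s → X s' → ∀ i → s (vs i) ≡ s' (vs i)

Inconst : {k : ℕ} → (Fin k → Var) → Atom
Inconst vs M X = Σ _ λ s → Σ _ λ s' → X s × X s' × ¬ (∀ i → s (vs i) ≡ s' (vs i))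

-- D v̄ is definable in FO(NE,⊔): some θ with free variables among v̄ such that
-- for every structure (nonempty domain M) and team X, D holds iff θ holds.
DefinableFONE⊔ : {k : ℕ} → (Fin k → Var) → Atom → Set₁
DefinableFONE⊔ vs D = Σ Formula λ θ →
  FreeAmong (λ u → Σ _ λ i → vs i ≡ u) θ ×
  ((M : Set) → M → (X : Team M) → (D M X → Sat M θ X) × (Sat M θ X → D M X))

module Submission where

-- Idea: over the empty vocabulary a formula can only compare the values of
-- its free variables for equality.  Call two assignments over ℕ of the same
-- equality type on a list L of variables when they make the same equalities
-- between variables of L true, and call two teams bisimilar on L when every
-- member of either team has a member of the other team of the same equality
-- type on L.  The quantifier cases need that an equality type can be
-- extended by a new variable (`extend`), which uses that ℕ is infinite.
-- Hence every definable atom is invariant under bisimilarity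
-- (`definable-invariant`).  Finally, the team {0̄} of the constant-0
-- assignment and the team {0̄, 1̄} are bisimilar on every L, since constant
-- assignments all make every equality true; but =(v̄) holds only in the
-- first and ≠(v̄) only in the second.

open import Defs
open import Data.Nat using (ℕ; suc; _≟_; s≤s)
open import Data.Nat.Properties using (<⇒≢; ≤-refl)
open import Data.Fin using (Fin) renaming (zero to fzero)
open import Data.Product using (Σ; ∃-syntax; _×_; _,_; proj₁; proj₂; swap)
open import Data.Sum using (_⊎_; inj₁; inj₂; [_,_]′; map₂)
open import Data.List using (List; _∷_; map; tabulate)
open import Data.List.Extrema.Nat using (max; v≤max⁺)
open import Data.List.Membership.Propositional using (_∈_; find; lose)
open import Data.List.Membership.Propositional.Properties using (∈-tabulate⁺; ∈-map⁺)
open import Data.List.Relation.Unary.Any using (here; there; tail; any?)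
open import Relation.Binary.PropositionalEquality
open import Relation.Nullary using (¬_; Dec; yes; no)
open import Data.Empty using (⊥-elim)
open import Level using (lift)

freeAmong-weaken : ∀ φ {P Q : Var → Set} → (∀ {u} → P u → Q u) → FreeAmong P φ → FreeAmong Q φ
freeAmong-weaken (eqL v w)  f (pv , pw) = f pv , f pw
freeAmong-weaken (neqL v w) f (pv , pw) = f pv , f pw
freeAmong-weaken NE         f _         = _
freeAmong-weaken (φ ∨ᶠ ψ)   f (pφ , pψ) = freeAmong-weaken φ f pφ , freeAmong-weaken ψ f pψ
freeAmong-weaken (φ ∧ᶠ ψ)   f (pφ , pψ) = freeAmong-weaken φ f pφ , freeAmong-weaken ψ f pψ
freeAmong-weaken (∃ᶠ v φ)   f pφ        = freeAmong-weaken φ (map₂ f) pφ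
freeAmong-weaken (∀ᶠ v φ)   f pφ        = freeAmong-weaken φ (map₂ f) pφ
freeAmong-weaken (φ ⊔ᶠ ψ)   f (pφ , pψ) = freeAmong-weaken φ f pφ , freeAmong-weaken ψ f pψ

update-at : {M : Set} (s : Assignment M) (v : Var) (m : M) → update s v m v ≡ m
update-at s v m with v ≟ v
... | yes _   = refl
... | no v≢v = ⊥-elim (v≢v refl)

update-away : {M : Set} (s : Assignment M) {v : Var} (m : M) {u : Var} → u ≢ v → update s v m u ≡ s u
update-away s {v} m {u} u≢v with u ≟ v
... | yes u≡v = ⊥-elim (u≢v u≡v)
... | no _    = refl

Agree : ℕ × ℕ → ℕ × ℕ → Set
Agree (a , b) (a′ , b′) = (a ≡ a′ → b ≡ b′) × (b ≡ b′ → a ≡ a′)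

agree-refl : ∀ {p} → Agree p p
agree-refl = (λ _ → refl) , (λ _ → refl)

agree-sym : ∀ {p q} → Agree p q → Agree q p
agree-sym (f , g) = (λ e → sym (f (sym e))) , (λ e → sym (g (sym e)))

SameEqType : List Var → Assignment ℕ → Assignment ℕ → Set
SameEqType L s t = ∀ {u w} → u ∈ L → w ∈ L → Agree (s u , t u) (s w , t w)

sameEqType-flip : ∀ {L s t} → SameEqType L s t → SameEqType L t s
sameEqType-flip e u∈ w∈ = swap (e u∈ w∈)

sameEqType-pointwise : ∀ {L s s′ t t′} → (∀ u → s′ u ≡ s u) → (∀ u → t′ u ≡ t u) →
  SameEqType L s t → SameEqType L s′ t′
sameEqType-pointwise {s = s} {s′} {t} {t′} s′≗s t′≗t e {u} {w} u∈ w∈ =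
  subst₂ Agree (sym (pair u)) (sym (pair w)) (e u∈ w∈)
  where
  pair : ∀ x → (s′ x , t′ x) ≡ (s x , t x)
  pair x = cong₂ _,_ (s′≗s x) (t′≗t x)

updated-pair : ∀ (s t : Assignment ℕ) v m m′ {L x} → x ∈ v ∷ L →
  (update s v m x , update t v m′ x) ≡ (m , m′) ⊎
  (x ∈ L × (update s v m x , update t v m′ x) ≡ (s x , t x))
updated-pair s t v m m′ {L} {x} x∈ = by-cases (x ≟ v)
  where
  by-cases : Dec (x ≡ v) →
    (update s v m x , update t v m′ x) ≡ (m , m′) ⊎
    (x ∈ L × (update s v m x , update t v m′ x) ≡ (s x , t x))
  by-cases (yes x≡v) = inj₁ (cong₂ _,_ (trans (cong (update s v m) x≡v) (update-at s v m))
                                       (trans (cong (update t v m′) x≡v) (update-at t v m′)))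
  by-cases (no x≢v)  = inj₂ (tail x≢v x∈ , cong₂ _,_ (update-away s m x≢v) (update-away t m′ x≢v))

sameEqType-update : ∀ {L s t} v m m′ → SameEqType L s t →
  (∀ {y} → y ∈ L → Agree (m , m′) (s y , t y)) →
  SameEqType (v ∷ L) (update s v m) (update t v m′)
sameEqType-update {s = s} {t} v m m′ e fits x∈ y∈
  with updated-pair s t v m m′ x∈ | updated-pair s t v m m′ y∈
... | inj₁ p         | inj₁ q         = subst₂ Agree (sym p) (sym q) agree-refl
... | inj₁ p         | inj₂ (y∈L , q) = subst₂ Agree (sym p) (sym q) (fits y∈L)
... | inj₂ (x∈L , p) | inj₁ q         = subst₂ Agree (sym p) (sym q) (agree-sym (fits x∈L))
... | inj₂ (x∈L , p) | inj₂ (y∈L , q) = subst₂ Agree (sym p) (sym q) (e x∈L y∈L)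

fresh : Assignment ℕ → List Var → ℕ
fresh t L = suc (max 0 (map t L))

fresh-new : ∀ t {L y} → y ∈ L → fresh t L ≢ t y
fresh-new t {L} y∈ = ≢-sym (<⇒≢ (s≤s (v≤max⁺ 0 (map t L) (inj₂ (lose (∈-map⁺ t y∈) ≤-refl)))))

-- Any value m for s has a counterpart for t: the value t takes at a variable
-- of L where s takes m, or, if there is none, a fresh value.
counterpart : ∀ {L s t} → SameEqType L s t → ∀ m →
  ∃[ m′ ] (∀ {y} → y ∈ L → Agree (m , m′) (s y , t y))
counterpart {L} {s} {t} e m with any? (λ u → s u ≟ m) L
... | yes hit = let (u , u∈ , su≡m) = find hit in
  t u , λ y∈ → subst (λ a → Agree (a , t u) _) su≡m (e u∈ y∈)
... | no miss = fresh t L ,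
  (λ y∈ → (λ m≡sy → ⊥-elim (miss (lose y∈ (sym m≡sy))))
            , (λ fresh≡ty → ⊥-elim (fresh-new t y∈ fresh≡ty)))

extend : ∀ {L s t} v m → SameEqType L s t →
  ∃[ m′ ] SameEqType (v ∷ L) (update s v m) (update t v m′)
extend v m e = let (m′ , fits) = counterpart e m in m′ , sameEqType-update v m m′ e fits

Covers : List Var → Team ℕ → Team ℕ → Set
Covers L X Y = ∀ {s} → X s → ∃[ t ] Y t × SameEqType L s t

Bisim : List Var → Team ℕ → Team ℕ → Set
Bisim L X Y = Covers L X Y × Covers L Y X

Splits : Team ℕ → Team ℕ → Team ℕ → Set
Splits X Y Z = ∀ s → (X s → Y s ⊎ Z s) × (Y s ⊎ Z s → X s)

Matching : List Var → Team ℕ → Team ℕ → Team ℕ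
Matching L Y X′ t = Y t × ∃[ s ] X′ s × SameEqType L t s

restrict : ∀ {L X Y X′} → Bisim L X Y → (∀ {s} → X′ s → X s) → Bisim L X′ (Matching L Y X′)
restrict (forth , _) X′⊆X =
  (λ {s} x′ → let (t , yt , e) = forth (X′⊆X x′) in t , (yt , s , x′ , sameEqType-flip e) , e) ,
  (λ (_ , s , x′ , e) → s , x′ , e)

split-bisim : ∀ {L X Y X₁ X₂} → Bisim L X Y → Splits X X₁ X₂ →
  Splits Y (Matching L Y X₁) (Matching L Y X₂) ×
  Bisim L X₁ (Matching L Y X₁) × Bisim L X₂ (Matching L Y X₂)
split-bisim {L} {X} {Y} {X₁} {X₂} B split =
  ySplit , restrict B (λ x₁ → proj₂ (split _) (inj₁ x₁)) , restrict B (λ x₂ → proj₂ (split _) (inj₂ x₂))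
  where
  side : ∀ {t s} → Y t → X s → SameEqType L t s → Matching L Y X₁ t ⊎ Matching L Y X₂ t
  side {s = s} yt xs e with proj₁ (split s) xs
  ... | inj₁ x₁ = inj₁ (yt , s , x₁ , e)
  ... | inj₂ x₂ = inj₂ (yt , s , x₂ , e)
  ySplit : Splits Y (Matching L Y X₁) (Matching L Y X₂)
  ySplit t = (λ yt → let (s , xs , e) = proj₂ B yt in side yt xs e) , [ proj₁ , proj₁ ]′

duplicate-covers : ∀ {L X Y} v → Covers L X Y → Covers (v ∷ L) (duplicate X v) (duplicate Y v)
duplicate-covers v forth (s , xs , m , s″≗) =
  let (t , yt , e) = forth xs
      (m′ , e′)    = extend v m e
  in update t v m′ , (t , yt , m′ , λ _ → refl) , sameEqType-pointwise s″≗ (λ _ → refl) e′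

duplicate-bisim : ∀ {L X Y} v → Bisim L X Y → Bisim (v ∷ L) (duplicate X v) (duplicate Y v)
duplicate-bisim v (forth , back) = duplicate-covers v forth , duplicate-covers v back

-- Bisimilarity is preserved by existentially quantifying a variable: the
-- choice F on X is transported to the choice on Y offering every value that
-- matches a value chosen for a matching member of X.
supplement-bisim : ∀ {L X Y} v F → Bisim L X Y → (∀ s → X s → Σ ℕ (F s)) →
  Σ (Assignment ℕ → ℕ → Set) λ F′ → (∀ t → Y t → Σ ℕ (F′ t)) ×
  Bisim (v ∷ L) (supplement X v F) (supplement Y v F′)
supplement-bisim {L} {X} {Y} v F (forth , back) total = F′ , total′ , forth′ , back′
  where
  F′ : Assignment ℕ → ℕ → Set
  F′ t m′ = ∃[ s ] X s × SameEqType L s t ×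
    ∃[ m ] F s m × SameEqType (v ∷ L) (update s v m) (update t v m′)
  total′ : ∀ t → Y t → Σ ℕ (F′ t)
  total′ t yt =
    let (s , xs , e) = back yt
        (m , fm)     = total s xs
        (m′ , e′)    = extend v m (sameEqType-flip e)
    in m′ , s , xs , sameEqType-flip e , m , fm , e′
  forth′ : Covers (v ∷ L) (supplement X v F) (supplement Y v F′)
  forth′ (s , xs , m , fm , s″≗) =
    let (t , yt , e) = forth xs
        (m′ , e′)    = extend v m e
    in update t v m′ , (t , yt , m′ , (s , xs , e , m , fm , e′) , λ _ → refl) ,
       sameEqType-pointwise s″≗ (λ _ → refl) e′
  back′ : Covers (v ∷ L) (supplement Y v F′) (supplement X v F)
  back′ (t , yt , m′ , (s , xs , e , m , fm , e′) , t″≗) =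
    update s v m , (s , xs , m , fm , λ _ → refl) ,
    sameEqType-pointwise t″≗ (λ _ → refl) (sameEqType-flip e′)

transfer : ∀ φ {L} {X Y : Team ℕ} → FreeAmong (_∈ L) φ → Bisim L X Y → Sat ℕ φ X → Sat ℕ φ Y
transfer (eqL v w) (v∈ , w∈) (_ , back) (lift holds) =
  lift λ t yt → let (s , xs , e) = back yt in proj₂ (e v∈ w∈) (holds s xs)
transfer (neqL v w) (v∈ , w∈) (_ , back) (lift holds) =
  lift λ t yt tv≡tw → let (s , xs , e) = back yt in holds s xs (proj₁ (e v∈ w∈) tv≡tw)
transfer NE _ (forth , _) (lift (s , xs)) = let (t , yt , _) = forth xs in lift (t , yt)
transfer (φ ∨ᶠ ψ) (fφ , fψ) B (X₁ , X₂ , split , satφ , satψ) =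
  let (ySplit , B₁ , B₂) = split-bisim B split
  in _ , _ , ySplit , transfer φ fφ B₁ satφ , transfer ψ fψ B₂ satψ
transfer (φ ∧ᶠ ψ) (fφ , fψ) B (satφ , satψ) = transfer φ fφ B satφ , transfer ψ fψ B satψ
transfer (∃ᶠ v φ) fφ B (F , total , satφ) =
  let (F′ , total′ , B′) = supplement-bisim v F B total
  in F′ , total′ , transfer φ (freeAmong-weaken φ [ here , there ]′ fφ) B′ satφ
transfer (∀ᶠ v φ) fφ B satφ =
  transfer φ (freeAmong-weaken φ [ here , there ]′ fφ) (duplicate-bisim v B) satφ
transfer (φ ⊔ᶠ ψ) (fφ , fψ) B (inj₁ satφ) = inj₁ (transfer φ fφ B satφ)
transfer (φ ⊔ᶠ ψ) (fφ , fψ) B (inj₂ satψ) = inj₂ (transfer ψ fψ B satψ)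

definable-invariant : ∀ {k} {vs : Fin k → Var} {D : Atom} {X Y : Team ℕ} →
  DefinableFONE⊔ vs D → Bisim (tabulate vs) X Y → D ℕ X → D ℕ Y
definable-invariant {vs = vs} {X = X} {Y} (θ , free , defines) B d =
  proj₂ (defines ℕ 0 Y) (transfer θ (freeAmong-weaken θ listed free) B (proj₁ (defines ℕ 0 X) d))
  where
  listed : ∀ {u} → Σ _ (λ i → vs i ≡ u) → u ∈ tabulate vs
  listed (i , refl) = ∈-tabulate⁺ i

Constant : ℕ → Assignment ℕ → Set
Constant c s = ∀ u → s u ≡ c

Zero ZeroOne : Team ℕ
Zero = Constant 0
ZeroOne s = Constant 0 s ⊎ Constant 1 s

-- Constant assignments make every equality true, so all share one equality type.
constant-sameEqType : ∀ {L a b s t} → Constant a s → Constant b t → SameEqType L s t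
constant-sameEqType {s = s} {t} s≡a t≡b {u} {w} _ _ =
  (λ _ → trans (t≡b u) (sym (t≡b w))) , (λ _ → trans (s≡a u) (sym (s≡a w)))

zeroOne-bisim : ∀ L → Bisim L ZeroOne Zero
zeroOne-bisim L =
  (λ s∈ → (λ _ → 0) , (λ _ → refl) , [ constant-sameEqType , constant-sameEqType ]′ s∈ (λ _ → refl)) ,
  (λ {t} t≡0 → t , inj₁ t≡0 , constant-sameEqType t≡0 t≡0)

zeroOne-differ : ∀ {n} → ¬ ((i : Fin (suc n)) → 0 ≡ 1)
zeroOne-differ all-equal with all-equal fzero
... | ()

mainTheorem10 : (n : ℕ) (vs : Fin (suc n) → Var) → (∀ i j → vs i ≡ vs j → i ≡ j) →
    ¬ DefinableFONE⊔ vs (Const vs) × ¬ DefinableFONE⊔ vs (Inconst vs)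
mainTheorem10 n vs _ = constancy-undefinable , inconstancy-undefinable
  where
  B : Bisim (tabulate vs) ZeroOne Zero
  B = zeroOne-bisim (tabulate vs)
  constancy-undefinable : ¬ DefinableFONE⊔ vs (Const vs)
  constancy-undefinable def =
    let const-ZeroOne = definable-invariant def (swap B) (λ s s′ s≡0 s′≡0 i → trans (s≡0 _) (sym (s′≡0 _)))
    in zeroOne-differ (const-ZeroOne (λ _ → 0) (λ _ → 1) (inj₁ λ _ → refl) (inj₂ λ _ → refl))
  inconstancy-undefinable : ¬ DefinableFONE⊔ vs (Inconst vs)
  inconstancy-undefinable def =
    let (s , s′ , s≡0 , s′≡0 , differ) = definable-invariant def B
          ((λ _ → 0) , (λ _ → 1) , inj₁ (λ _ → refl) , inj₂ (λ _ → refl) , zeroOne-differ)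
    in differ (λ i → trans (s≡0 _) (sym (s′≡0 _)))
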